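{- Let $n\in\mathbb{N}$ and $w\in\mathcal{C}_{n,0}$. Then $w\in\mathcal{M}_n$ if and only if $w$ has no odd sandwich.
   Context: For $n\in\mathbb{N}$ let $[n]=\{1,\dots,n\}$, $[\pm n]_0=\{ -n,\dots,n\}$. $B_n$ is the group of permutations $w$ of $[\pm n]_0$ with $w(-j)=-w(j)$; $S_n=\{w\in B_n: w(j)>0\ \forall j\in[n]\}$. $\mathcal{C}_{n,0}=\{w: |w(j)|\equiv j\pmod 2\ \forall j\in[n]\}$, $\mathcal{C}_{n,1}=\{w: |w(j)|\not\equiv j\pmod 2\ \forall j\in[n]\}$. Every $w\in B_n$ has a unique factorisation $w=uv$ with $u$ ascending ($u(1)<\dots<u(n)$) and $v\in S_n$; write $w^{[n-1]}=u$, $w_{[n-1]}=v$. $\mathcal{M}_n=\{w\in\mathcal{C}_{n,0}: \text{both } w^{[n-1]},w_{[n-1]}\in\mathcal{C}_{n,0}\text{ or both }\in\mathcal{C}_{n,1}\}$. For $r\in[n]$ let $\varepsilon_r\in\{\pm1\}$ be the sign of $w^{ -1}(r)$ (the sign of the nonzero entry in row $r$ of the signed permutation matrix of $w$). A pair $(r,h)$ with $r\in[n-2]$, $h\in[n-1]$ odd and $r+h+1\le n$ is an odd sandwich in $w$ if either (1) $\varepsilon_r=\varepsilon_{r+h+1}$ and $\varepsilon_r\neq\varepsilon_{r+i}$ for all $i\in[h]$; or (2) $r=1$, $\varepsilon_1=\varepsilon_{1+i}$ for all $i\in[h]$, and $\varepsilon_1\neq\varepsilon_{h+2}$. -}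

module Defs where

open import Data.Nat as ℕ using (ℕ; zero; suc; _%_; _∸_)
open import Data.Integer as ℤ using (ℤ; +_; -[1+_]; ∣_∣)
open import Data.Fin using (Fin; toℕ)
import Data.Fin as Fin
open import Data.Bool using (Bool)
open import Data.Bool.ListAction using (any)
open import Data.List.Base using (allFin)
open import Data.Product using (Σ; _×_; ∃)
open import Data.Sum using (_⊎_)
open import Relation.Nullary using (¬_)
open import Relation.Nullary.Decidable using (⌊_⌋)
open import Relation.Binary.PropositionalEquality using (_≡_; _≢_)

-- A signed permutation w ∈ B_n is represented by its values on [n]:
-- w : Fin n → ℤ with  w j  standing for  w(toℕ j + 1).
-- (Values on -[n] and 0 are then determined by w(-j) = -w(j), w(0) = 0.)
IsSignedPerm : (n : ℕ) → (Fin n → ℤ) → Set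
IsSignedPerm n w =
  (∀ j → 1 ℕ.≤ ∣ w j ∣ × ∣ w j ∣ ℕ.≤ n) ×
  (∀ i j → ∣ w i ∣ ≡ ∣ w j ∣ → i ≡ j)

-- value w(k+1) for a 0-based index k (0 if out of range; never used out of range)
at : ∀ {n} → (Fin n → ℤ) → ℕ → ℤ
at {zero}  w k       = + 0
at {suc n} w zero    = w Fin.zero
at {suc n} w (suc k) = at {n} (λ j → w (Fin.suc j)) k

-- the extension of w to [±n]_0 : w(0) = 0, w(k) for k ∈ [n], w(-k) = -w(k)
ext : ∀ {n} → (Fin n → ℤ) → ℤ → ℤ
ext w (+ zero)  = + 0
ext w (+ suc k) = at w k
ext w -[1+ k ]  = ℤ.- at w k

InS : (n : ℕ) → (Fin n → ℤ) → Set
InS n v = IsSignedPerm n v × (∀ j → + 0 ℤ.< v j)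

Ascending : (n : ℕ) → (Fin n → ℤ) → Set
Ascending n u = ∀ i j → i Fin.< j → u i ℤ.< u j

InC0 : (n : ℕ) → (Fin n → ℤ) → Set
InC0 n w = ∀ j → ∣ w j ∣ % 2 ≡ suc (toℕ j) % 2

InC1 : (n : ℕ) → (Fin n → ℤ) → Set
InC1 n w = ∀ j → ∣ w j ∣ % 2 ≢ suc (toℕ j) % 2

-- w = u v  (composition: (uv)(j) = u(v(j))), with u ascending and v ∈ S_n,
-- i.e. u = w^{[n-1]} and v = w_{[n-1]}
IsParabolicFactorisation : (n : ℕ) → (w u v : Fin n → ℤ) → Set
IsParabolicFactorisation n w u v =
  IsSignedPerm n u × Ascending n u × InS n v × (∀ j → w j ≡ ext u (v j))

-- M_n : w ∈ C_{n,0} and for the (unique) factorisation w = w^{[n-1]} w_{[n-1]},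
-- both factors lie in C_{n,0} or both lie in C_{n,1}
InM : (n : ℕ) → (Fin n → ℤ) → Set
InM n w = InC0 n w ×
  (∀ u v → IsParabolicFactorisation n w u v →
     (InC0 n u × InC0 n v) ⊎ (InC1 n u × InC1 n v))

-- ε_r = sign of w^{-1}(r): true (= +1) iff w(j) = r for some j ∈ [n]
-- (otherwise w(j) = -r for some j, i.e. w^{-1}(r) = -j < 0)
ε : ∀ {n} → (Fin n → ℤ) → ℕ → Bool
ε {n} w r = any (λ j → ⌊ w j ℤ.≟ + r ⌋) (allFin n)

OddSandwich : (n : ℕ) → (Fin n → ℤ) → ℕ → ℕ → Set
OddSandwich n w r h =
  (1 ℕ.≤ r × r ℕ.≤ n ∸ 2) × (1 ℕ.≤ h × h ℕ.≤ n ∸ 1 × h % 2 ≡ 1) ×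
  (r ℕ.+ h ℕ.+ 1 ℕ.≤ n) ×
  ( (ε w r ≡ ε w (r ℕ.+ h ℕ.+ 1) ×
       (∀ i → 1 ℕ.≤ i → i ℕ.≤ h → ε w r ≢ ε w (r ℕ.+ i)))
  ⊎ (r ≡ 1 ×
       (∀ i → 1 ℕ.≤ i → i ℕ.≤ h → ε w 1 ≡ ε w (1 ℕ.+ i)) ×
       ε w 1 ≢ ε w (h ℕ.+ 2)) )

HasOddSandwich : (n : ℕ) → (Fin n → ℤ) → Set
HasOddSandwich n w = Σ ℕ λ r → Σ ℕ λ h → OddSandwich n w r h

module Submission where

-- Factor w = u v with u = w^{[n-1]} ascending and v = w_{[n-1]} ∈ S_n.
-- (1) The values of u are exactly the signed values ε_r · r (r ∈ [n]) of w, listed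
--     in increasing order; and since w ∈ C_{n,0}, v lies in the same parity class
--     as u.  So w ∈ M_n iff u ∈ C_{n,0} ∪ C_{n,1}, i.e. iff the parities of
--     |u(1)|, …, |u(n)| alternate.
-- (2) For ascending u, consecutive positions carry neighbouring values, so this
--     says: any two neighbours a < b in the set of signed values have |a| and |b|
--     of different parity.
-- (3) Purely about a sign vector ε: a pair of neighbouring signed values of equal
--     parity is exactly what an odd sandwich describes (case (1): +r, +(r+h+1) or
--     −(r+h+1), −r; case (2): −(h+2), +1 or −1, +(h+2)).

open import Defs
open import Data.Nat as ℕ using (ℕ; zero; suc; _+_; _≤_; _<_; _%_; _∸_; z≤n; s≤s)
import Data.Nat.Properties as ℕP
open import Data.Integer as ℤ using (ℤ; +_; -[1+_]; ∣_∣; +<+; -<+; -<-)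
import Data.Integer.Properties as ℤP
open import Data.Fin as Fin using (Fin; toℕ; fromℕ<; punchOut)
import Data.Fin.Properties as FinP
open import Data.Fin.Subset using (Subset; _∈_) renaming (∣_∣ to size)
import Data.Fin.Subset.Properties as SubsetP
open import Data.Vec using (tabulate)
open import Data.Vec.Properties using (lookup∘tabulate; []=⇒lookup; lookup⇒[]=)
open import Data.Bool using (Bool; true; false; not; _xor_; if_then_else_)
open import Data.Bool.Properties
  using (not-involutive; ¬-not; not-¬; xor-identityʳ; not-distribˡ-xor; not-distribʳ-xor; T-≡)
import Data.Bool.Properties as BoolP
open import Data.List.Base using (allFin)
open import Data.List.Relation.Unary.Any using (satisfied)
open import Data.List.Relation.Unary.Any.Properties using (any⁺; any⁻)
open import Data.List.Membership.Propositional using (lose)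
open import Data.List.Membership.Propositional.Properties using (∈-allFin)
open import Data.Product using (Σ; _×_; ∃; ∃₂; _,_; proj₁; proj₂)
open import Data.Sum as Sum using (_⊎_; inj₁; inj₂)
open import Function using (_∘_)
open import Function.Bundles using (Equivalence)
open import Function.Definitions using (Injective)
open import Relation.Nullary using (¬_; yes; no; does; contradiction)
open import Relation.Nullary.Decidable using (⌊_⌋; toWitness; fromWitness; dec-true)
open import Relation.Unary using (Pred; _⊆_)
open import Relation.Binary using (tri<; tri≈; tri>)
open import Relation.Binary.PropositionalEquality
  using (_≡_; _≢_; refl; sym; trans; cong; subst; subst₂; module ≡-Reasoning)

other : ∀ {x y b} → x ≡ b → x ≢ y → y ≡ not b
other refl x≢y = ¬-not (x≢y ∘ sym)

opposite : ∀ {x y a} → x ≡ a → y ≡ not a → x ≢ y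
opposite refl refl = not-¬ refl

xor≡true : ∀ {x y} → x xor y ≡ true → x ≡ not y
xor≡true {true}  {false} _ = refl
xor≡true {false} {true}  _ = refl

xor≡false : ∀ {x y} → x xor y ≡ false → x ≡ y
xor≡false {true}  {true}  _ = refl
xor≡false {false} {false} _ = refl

odd : ℕ → Bool
odd zero    = false
odd (suc m) = not (odd m)

%2≡odd : ∀ m → m % 2 ≡ (if odd m then 1 else 0)
%2≡odd zero          = refl
%2≡odd (suc zero)    = refl
%2≡odd (suc (suc m)) =
  trans (%2≡odd m) (cong (λ b → if b then 1 else 0) (sym (not-involutive (odd m))))

%2⇒odd : ∀ m k → m % 2 ≡ k % 2 → odd m ≡ odd k
%2⇒odd m k eq = bit-injective (odd m) (odd k) (trans (sym (%2≡odd m)) (trans eq (%2≡odd k)))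
  where
  bit-injective : ∀ x y → (if x then 1 else 0) ≡ (if y then 1 else 0) → x ≡ y
  bit-injective true  true  _  = refl
  bit-injective false false _  = refl
  bit-injective true  false ()
  bit-injective false true  ()

odd⇒%2 : ∀ m k → odd m ≡ odd k → m % 2 ≡ k % 2
odd⇒%2 m k eq =
  trans (%2≡odd m) (trans (cong (λ b → if b then 1 else 0) eq) (sym (%2≡odd k)))

odd-+ : ∀ a b → odd (a + b) ≡ odd a xor odd b
odd-+ zero    b = refl
odd-+ (suc a) b = trans (cong not (odd-+ a b)) (not-distribˡ-xor (odd a) (odd b))

odd⇒1≤ : ∀ {h} → odd h ≡ true → 1 ≤ h
odd⇒1≤ {suc _} _ = s≤s z≤n

gap-suc : ∀ r h → r + h + 1 ≡ suc (r + h)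
gap-suc r h = ℕP.+-comm (r + h) 1

gapForm : ∀ {a b} → a < b → ∃ λ h → a + h + 1 ≡ b
gapForm {a} {b} a<b = b ∸ suc a , trans (gap-suc a (b ∸ suc a)) (ℕP.m+[n∸m]≡n a<b)

between : ∀ {a s h} → a < s → s < a + h + 1 → ∃ λ i → 1 ≤ i × i ≤ h × s ≡ a + i
between {a} {s} {h} a<s s<end = s ∸ a , ℕP.m<n⇒0<n∸m a<s , within , sym split
  where
  split : a + (s ∸ a) ≡ s
  split = ℕP.m+[n∸m]≡n (ℕP.<⇒≤ a<s)
  within : s ∸ a ≤ h
  within = ℕP.+-cancelˡ-≤ a _ _ (subst (_≤ a + h) (sym split)
             (ℕP.m<1+n⇒m≤n (subst (s <_) (gap-suc a h) s<end)))

inside : ∀ a {i h} → 1 ≤ i → i ≤ h → a < a + i × a + i < a + h + 1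
inside a {i} {h} 1≤i i≤h =
  ℕP.m<m+n a 1≤i , subst (a + i <_) (sym (gap-suc a h)) (s≤s (ℕP.+-monoʳ-≤ a i≤h))

oddGap⇒sameParity : ∀ a h → odd h ≡ true → odd a ≡ odd (a + h + 1)
oddGap⇒sameParity a h oddh = begin
  odd a                       ≡⟨ flip-flip (odd a) ⟩
  not (odd a xor true)        ≡⟨ cong (λ b → not (odd a xor b)) (sym oddh) ⟩
  not (odd a xor odd h)       ≡⟨ cong not (sym (odd-+ a h)) ⟩
  odd (suc (a + h))           ≡⟨ cong odd (sym (gap-suc a h)) ⟩
  odd (a + h + 1)             ∎
  where
  open ≡-Reasoning
  flip-flip : ∀ x → x ≡ not (x xor true)
  flip-flip true  = refl
  flip-flip false = refl

sameParity⇒oddGap : ∀ a h → odd a ≡ odd (a + h + 1) → odd h ≡ true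
sameParity⇒oddGap a h same =
  fixed (odd a) (odd h) (trans same (trans (cong odd (gap-suc a h)) (cong not (odd-+ a h))))
  where
  fixed : ∀ x y → x ≡ not (x xor y) → y ≡ true
  fixed true  true  _  = refl
  fixed false true  _  = refl
  fixed true  false ()
  fixed false false ()

-- Sign vectors and odd sandwiches.  Throughout, e : ℕ → Bool plays the role of
-- r ↦ ε_r (true for +1) on [n].

isPositive : ℤ → Bool
isPositive (+ _)    = true
isPositive -[1+ _ ] = false

SignedValue : ℕ → (ℕ → Bool) → Pred ℤ _
SignedValue n e z = 1 ≤ ∣ z ∣ × ∣ z ∣ ≤ n × e ∣ z ∣ ≡ isPositive z

-- The two cases of an odd sandwich, for an arbitrary sign vector.  By definition
-- OddSandwich n w r h is SignSandwich n (ε w) r h.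
Enclosed : (ℕ → Bool) → ℕ → ℕ → Set
Enclosed e r h = e r ≡ e (r + h + 1) × (∀ i → 1 ≤ i → i ≤ h → e r ≢ e (r + i))

InitialRun : (ℕ → Bool) → ℕ → Set
InitialRun e h = (∀ i → 1 ≤ i → i ≤ h → e 1 ≡ e (1 + i)) × e 1 ≢ e (h + 2)

SignSandwich : ℕ → (ℕ → Bool) → ℕ → ℕ → Set
SignSandwich n e r h =
  (1 ≤ r × r ≤ n ∸ 2) × (1 ≤ h × h ≤ n ∸ 1 × h % 2 ≡ 1) ×
  (r + h + 1 ≤ n) × (Enclosed e r h ⊎ (r ≡ 1 × InitialRun e h))

HasSignSandwich : ℕ → (ℕ → Bool) → Set
HasSignSandwich n e = Σ ℕ λ r → Σ ℕ λ h → SignSandwich n e r h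

Neighbours : Pred ℤ _ → ℤ → ℤ → Set
Neighbours P a b = P a × P b × a ℤ.< b × (∀ z → a ℤ.< z → z ℤ.< b → ¬ P z)

ParityAlternates : Pred ℤ _ → Set
ParityAlternates P = ∀ a b → Neighbours P a b → odd ∣ a ∣ ≢ odd ∣ b ∣

neighbours-resp : ∀ {P Q : Pred ℤ _} {a b} → P ⊆ Q → Q ⊆ P →
                  Neighbours P a b → Neighbours Q a b
neighbours-resp P⊆Q Q⊆P (pa , pb , a<b , empty) =
  P⊆Q pa , P⊆Q pb , a<b , λ z a<z z<b qz → empty z a<z z<b (Q⊆P qz)

alternates-resp : ∀ {P Q : Pred ℤ _} → P ⊆ Q → Q ⊆ P →
                  ParityAlternates P → ParityAlternates Q
alternates-resp P⊆Q Q⊆P alt a b nb = alt a b (neighbours-resp Q⊆P P⊆Q nb)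

Clash : Pred ℤ _ → Set
Clash P = ∃₂ λ a b → Neighbours P a b × odd ∣ a ∣ ≡ odd ∣ b ∣

module SignVector (n : ℕ) (e : ℕ → Bool) where

  Value : Pred ℤ _
  Value = SignedValue n e

  mkSandwich : ∀ {r h} → 1 ≤ r → odd h ≡ true → r + h + 1 ≤ n →
               Enclosed e r h ⊎ (r ≡ 1 × InitialRun e h) → SignSandwich n e r h
  mkSandwich {r} {h} 1≤r oddh bound kind =
    (1≤r , r≤n∸2) , (1≤h , h≤n∸1 , odd⇒%2 h 1 oddh) , bound , kind
    where
    1≤h : 1 ≤ h
    1≤h = odd⇒1≤ oddh
    r≤n∸2 : r ≤ n ∸ 2
    r≤n∸2 = ℕP.m+n≤o⇒m≤o∸n r (ℕP.≤-trans (ℕP.+-monoʳ-≤ r (s≤s 1≤h))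
              (subst (_≤ n) (trans (gap-suc r h) (sym (ℕP.+-suc r h))) bound))
    h≤n∸1 : h ≤ n ∸ 1
    h≤n∸1 = ℕP.m+n≤o⇒m≤o∸n h (ℕP.m+n≤o⇒n≤o r (subst (_≤ n) (ℕP.+-assoc r h 1) bound))

  absent⁺ : ∀ {m} → 1 ≤ m → m ≤ n → ¬ Value (+ m) → e m ≡ false
  absent⁺ 1≤m m≤n ∉ = ¬-not (λ em → ∉ (1≤m , m≤n , em))

  absent⁻ : ∀ {s} → suc s ≤ n → ¬ Value -[1+ s ] → e (suc s) ≡ true
  absent⁻ s<n ∉ = ¬-not (λ es → ∉ (s≤s z≤n , s<n , es))

  enclosed⁺ : ∀ {r h} → 1 ≤ r → r + h + 1 ≤ n → e r ≡ true → Enclosed e r h →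
              Neighbours Value (+ r) (+ (r + h + 1))
  enclosed⁺ {r} {h} 1≤r bound er (same , flips) =
    (1≤r , ℕP.≤-trans (ℕP.<⇒≤ r<end) bound , er) ,
    (ℕP.≤-trans (s≤s z≤n) r<end , bound , trans (sym same) er) ,
    +<+ r<end , empty
    where
    r<end : r < r + h + 1
    r<end = subst (r <_) (sym (gap-suc r h)) (s≤s (ℕP.m≤m+n r h))
    empty : ∀ z → + r ℤ.< z → z ℤ.< + (r + h + 1) → ¬ Value z
    empty (+ s) (+<+ r<s) (+<+ s<end) (_ , _ , es) with between r<s s<end
    ... | i , 1≤i , i≤h , refl = flips i 1≤i i≤h (trans er (sym es))

  enclosed⁻ : ∀ {p h} → suc p + h + 1 ≤ n → e (suc p) ≡ false → Enclosed e (suc p) h →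
              Neighbours Value -[1+ p + h + 1 ] -[1+ p ]
  enclosed⁻ {p} {h} bound ep (same , flips) =
    (s≤s z≤n , bound , trans (sym same) ep) ,
    (s≤s z≤n , ℕP.≤-trans (s≤s (ℕP.<⇒≤ p<end)) bound , ep) ,
    -<- p<end , empty
    where
    p<end : p < p + h + 1
    p<end = subst (p <_) (sym (gap-suc p h)) (s≤s (ℕP.m≤m+n p h))
    empty : ∀ z → -[1+ p + h + 1 ] ℤ.< z → z ℤ.< -[1+ p ] → ¬ Value z
    empty -[1+ s ] (-<- s<end) (-<- p<s) (_ , _ , es) with between p<s s<end
    ... | i , 1≤i , i≤h , refl = flips i 1≤i i≤h (trans ep (sym es))

  initialRun⁺ : ∀ {h} → suc (suc h) ≤ n → e 1 ≡ true → InitialRun e h →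
                Neighbours Value -[1+ suc h ] (+ 1)
  initialRun⁺ {h} bound e1 (same , differ) =
    (s≤s z≤n , bound , subst (λ m → e m ≡ false) (ℕP.+-comm h 2) (other e1 differ)) ,
    (s≤s z≤n , ℕP.≤-trans (s≤s z≤n) bound , e1) , -<+ , empty
    where
    empty : ∀ z → -[1+ suc h ] ℤ.< z → z ℤ.< + 1 → ¬ Value z
    empty -[1+ zero ]  _ _ (_ , _ , e1≡false) = contradiction (trans (sym e1) e1≡false) λ ()
    empty -[1+ suc i ] (-<- (s≤s i<h)) _ (_ , _ , es) =
      contradiction (trans (sym e1) (trans (same (suc i) (s≤s z≤n) i<h) es)) λ ()
    empty (+ zero)     _ _ (() , _)
    empty (+ suc _)    _ (+<+ (s≤s ())) _

  initialRun⁻ : ∀ {h} → suc (suc h) ≤ n → e 1 ≡ false → InitialRun e h →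
                Neighbours Value -[1+ 0 ] (+ suc (suc h))
  initialRun⁻ {h} bound e1 (same , differ) =
    (s≤s z≤n , ℕP.≤-trans (s≤s z≤n) bound , e1) ,
    (s≤s z≤n , bound , subst (λ m → e m ≡ true) (ℕP.+-comm h 2) (other e1 differ)) ,
    -<+ , empty
    where
    empty : ∀ z → -[1+ 0 ] ℤ.< z → z ℤ.< + suc (suc h) → ¬ Value z
    empty -[1+ _ ]          (-<- ()) _ _
    empty (+ zero)          _ _ (() , _)
    empty (+ suc zero)      _ _ (_ , _ , e1≡true) = contradiction (trans (sym e1) e1≡true) λ ()
    empty (+ suc (suc i))   _ (+<+ (s≤s (s≤s i<h))) (_ , _ , es) =
      contradiction (trans (sym es) (trans (sym (same (suc i) (s≤s z≤n) i<h)) e1)) λ ()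

  enclosedClash : ∀ {r h} → 1 ≤ r → r + h + 1 ≤ n → odd h ≡ true → Enclosed e r h →
                  ∀ b → e r ≡ b → Clash Value
  enclosedClash {r} {h} 1≤r bound oddh enc true er =
    + r , + (r + h + 1) , enclosed⁺ 1≤r bound er enc , oddGap⇒sameParity r h oddh
  enclosedClash {suc p} {h} _ bound oddh enc false ep =
    -[1+ p + h + 1 ] , -[1+ p ] , enclosed⁻ bound ep enc ,
    sym (oddGap⇒sameParity (suc p) h oddh)

  initialRunClash : ∀ {h} → suc (suc h) ≤ n → odd h ≡ true → InitialRun e h →
                    ∀ b → e 1 ≡ b → Clash Value
  initialRunClash {h} bound oddh run true e1 =
    -[1+ suc h ] , + 1 , initialRun⁺ bound e1 run , trans (not-involutive (odd h)) oddh
  initialRunClash {h} bound oddh run false e1 =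
    -[1+ 0 ] , + suc (suc h) , initialRun⁻ bound e1 run , sym (trans (not-involutive (odd h)) oddh)

  sandwich⇒clash : HasSignSandwich n e → Clash Value
  sandwich⇒clash (r , h , (1≤r , _) , (_ , _ , h%2) , bound , inj₁ enc) =
    enclosedClash 1≤r bound (%2⇒odd h 1 h%2) enc (e r) refl
  sandwich⇒clash (_ , h , _ , (_ , _ , h%2) , bound , inj₂ (refl , run)) =
    initialRunClash (subst (_≤ n) (gap-suc 1 h) bound) (%2⇒odd h 1 h%2) run (e 1) refl

  -- Conversely, neighbours of equal parity form an odd sandwich: of case (1) when
  -- they have the same sign, of case (2) when they have opposite signs.
  positivePair : ∀ {p q} → Neighbours Value (+ p) (+ q) → odd p ≡ odd q → HasSignSandwich n e
  positivePair {p} ((1≤p , _ , ep) , (_ , q≤n , eq) , +<+ p<q , empty) same with gapForm p<q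
  ... | h , refl =
    p , h , mkSandwich 1≤p (sameParity⇒oddGap p h same) q≤n (inj₁ (trans ep (sym eq) , flips))
    where
    flips : ∀ i → 1 ≤ i → i ≤ h → e p ≢ e (p + i)
    flips i 1≤i i≤h epi = empty (+ (p + i)) (+<+ (proj₁ gaps)) (+<+ (proj₂ gaps))
      (ℕP.≤-trans 1≤p (ℕP.m≤m+n p i) , ℕP.≤-trans (ℕP.<⇒≤ (proj₂ gaps)) q≤n , trans (sym epi) ep)
      where
      gaps : p < p + i × p + i < p + h + 1
      gaps = inside p 1≤i i≤h

  negativePair : ∀ {p q} → Neighbours Value -[1+ q ] -[1+ p ] → odd (suc q) ≡ odd (suc p) →
                 HasSignSandwich n e
  negativePair {p} ((_ , q<n , eq) , (_ , _ , ep) , -<- p<q , empty) same with gapForm p<q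
  ... | h , refl =
    suc p , h ,
    mkSandwich (s≤s z≤n) (sameParity⇒oddGap (suc p) h (sym same)) q<n (inj₁ (trans ep (sym eq) , flips))
    where
    flips : ∀ i → 1 ≤ i → i ≤ h → e (suc p) ≢ e (suc p + i)
    flips i 1≤i i≤h epi = empty -[1+ p + i ] (-<- (proj₂ gaps)) (-<- (proj₁ gaps))
      (s≤s z≤n , ℕP.≤-trans (proj₂ gaps) (ℕP.<⇒≤ q<n) , trans (sym epi) ep)
      where
      gaps : p < p + i × p + i < p + h + 1
      gaps = inside p 1≤i i≤h

  -- −(p+1) < +q: since −1 and +1 cannot both be skipped, one of them is an
  -- endpoint, and the pair is −1, +(h+2) or −(h+2), +1, i.e. case (2) with r = 1.
  mixedPair : ∀ p q → Neighbours Value -[1+ p ] (+ q) → odd (suc p) ≡ odd q → HasSignSandwich n e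
  mixedPair _ zero (_ , (() , _) , _) _
  mixedPair zero (suc zero) ((_ , _ , e1≡false) , (_ , _ , e1≡true) , _) _ =
    contradiction (trans (sym e1≡false) e1≡true) λ ()
  mixedPair zero (suc (suc h)) ((_ , _ , e1) , (_ , bound , eh) , _ , empty) same =
    1 , h , mkSandwich (s≤s z≤n) (sym (trans same (not-involutive (odd h))))
              (subst (_≤ n) (sym (gap-suc 1 h)) bound) (inj₂ (refl , run , differ))
    where
    run : ∀ i → 1 ≤ i → i ≤ h → e 1 ≡ e (1 + i)
    run i _ i≤h = trans e1 (sym (absent⁺ (s≤s z≤n) (ℕP.≤-trans (s≤s (ℕP.m≤n⇒m≤1+n i≤h)) bound)
                    (empty (+ suc i) -<+ (+<+ (s≤s (s≤s i≤h))))))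
    differ : e 1 ≢ e (h + 2)
    differ e1≡eh = contradiction (trans (sym e1) (trans e1≡eh
                     (subst (λ m → e m ≡ true) (sym (ℕP.+-comm h 2)) eh))) λ ()
  mixedPair (suc h) (suc zero) ((_ , bound , eh) , (_ , _ , e1) , _ , empty) same =
    1 , h , mkSandwich (s≤s z≤n) (trans (sym (not-involutive (odd h))) same)
              (subst (_≤ n) (sym (gap-suc 1 h)) bound) (inj₂ (refl , run , differ))
    where
    run : ∀ i → 1 ≤ i → i ≤ h → e 1 ≡ e (1 + i)
    run i _ i≤h = trans e1 (sym (absent⁻ (ℕP.≤-trans (s≤s (ℕP.m≤n⇒m≤1+n i≤h)) bound)
                    (empty -[1+ i ] (-<- (s≤s i≤h)) -<+)))
    differ : e 1 ≢ e (h + 2)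
    differ e1≡eh = contradiction (trans (sym e1) (trans e1≡eh
                     (subst (λ m → e m ≡ false) (sym (ℕP.+-comm h 2)) eh))) λ ()
  mixedPair (suc _) (suc (suc _)) (_ , (_ , q≤n , _) , _ , empty) _ =
    contradiction (trans (sym (absent⁻ 1≤n (empty -[1+ 0 ] (-<- (s≤s z≤n)) -<+)))
                         (absent⁺ (s≤s z≤n) 1≤n (empty (+ 1) -<+ (+<+ (s≤s (s≤s z≤n)))))) λ ()
    where
    1≤n : 1 ≤ n
    1≤n = ℕP.≤-trans (s≤s z≤n) q≤n

  clash⇒sandwich : ∀ a b → Neighbours Value a b → odd ∣ a ∣ ≡ odd ∣ b ∣ → HasSignSandwich n e
  clash⇒sandwich (+ _)    (+ _)    nb          same = positivePair nb same
  clash⇒sandwich -[1+ _ ] -[1+ _ ] nb          same = negativePair nb same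
  clash⇒sandwich -[1+ p ] (+ q)    nb          same = mixedPair p q nb same
  clash⇒sandwich (+ _)    -[1+ _ ] (_ , _ , () , _) _

  alternates⇒noSandwich : ParityAlternates Value → ¬ HasSignSandwich n e
  alternates⇒noSandwich alt s = let (a , b , nb , same) = sandwich⇒clash s in alt a b nb same

  noSandwich⇒alternates : ¬ HasSignSandwich n e → ParityAlternates Value
  noSandwich⇒alternates ns a b nb same = ns (clash⇒sandwich a b nb same)

Range : ∀ {n} → (Fin n → ℤ) → Pred ℤ _
Range u z = ∃ λ k → u k ≡ z

ConsecutiveAlternate : ∀ {n} → (Fin n → ℤ) → Set
ConsecutiveAlternate u = ∀ k k' → toℕ k' ≡ suc (toℕ k) → odd ∣ u k ∣ ≢ odd ∣ u k' ∣

module AscendingEnumeration {n} (u : Fin n → ℤ) (ascending : Ascending n u) where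

  reflect : ∀ i j → u i ℤ.< u j → i Fin.< j
  reflect i j ui<uj with FinP.<-cmp i j
  ... | tri< i<j _ _ = i<j
  ... | tri≈ _ refl _ = contradiction ui<uj (ℤP.<-irrefl refl)
  ... | tri> _ _ j<i = contradiction ui<uj (ℤP.<-asym (ascending j i j<i))

  neighbours⇒consecutive : ∀ k k' → Neighbours (Range u) (u k) (u k') → toℕ k' ≡ suc (toℕ k)
  neighbours⇒consecutive k k' (_ , _ , uk<uk' , empty) with ℕP.m≤n⇒m<n∨m≡n (reflect k k' uk<uk')
  ... | inj₂ next = sym next
  ... | inj₁ gap  = contradiction (middle , refl)
                      (empty (u middle) (ascending k middle k<middle) (ascending middle k' middle<k'))
    where
    middle : Fin n
    middle = fromℕ< (ℕP.<-trans gap (FinP.toℕ<n k'))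
    k<middle : k Fin.< middle
    k<middle = subst (toℕ k <_) (sym (FinP.toℕ-fromℕ< _)) ℕP.≤-refl
    middle<k' : middle Fin.< k'
    middle<k' = subst (_< toℕ k') (sym (FinP.toℕ-fromℕ< _)) gap

  consecutive⇒neighbours : ∀ k k' → toℕ k' ≡ suc (toℕ k) → Neighbours (Range u) (u k) (u k')
  consecutive⇒neighbours k k' next =
    (k , refl) , (k' , refl) , ascending k k' (ℕP.≤-reflexive (sym next)) , empty
    where
    empty : ∀ z → u k ℤ.< z → z ℤ.< u k' → ¬ Range u z
    empty _ uk<um um<uk' (m , refl) = ℕP.<⇒≱ (reflect k m uk<um)
      (ℕP.m<1+n⇒m≤n (subst (toℕ m <_) next (reflect m k' um<uk')))

  alternates⇒consecutive : ParityAlternates (Range u) → ConsecutiveAlternate u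
  alternates⇒consecutive alt k k' next = alt (u k) (u k') (consecutive⇒neighbours k k' next)

  consecutive⇒alternates : ConsecutiveAlternate u → ParityAlternates (Range u)
  consecutive⇒alternates alt _ _ nb@((k , refl) , (k' , refl) , _) =
    alt k k' (neighbours⇒consecutive k k' nb)

c0-parity : ∀ {n} {u : Fin n → ℤ} → InC0 n u → ∀ j → odd ∣ u j ∣ ≡ odd (suc (toℕ j))
c0-parity {u = u} c0 j = %2⇒odd ∣ u j ∣ (suc (toℕ j)) (c0 j)

c1-parity : ∀ {n} {u : Fin n → ℤ} → InC1 n u → ∀ j → odd ∣ u j ∣ ≡ odd (toℕ j)
c1-parity {u = u} c1 j =
  trans (¬-not (λ same → c1 j (odd⇒%2 ∣ u j ∣ (suc (toℕ j)) same))) (not-involutive _)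

classes⇒consecutive : ∀ {n} (u : Fin n → ℤ) → InC0 n u ⊎ InC1 n u → ConsecutiveAlternate u
classes⇒consecutive u (inj₁ c0) k k' next =
  opposite (c0-parity {u = u} c0 k) (trans (c0-parity {u = u} c0 k') (cong (odd ∘ suc) next))
classes⇒consecutive u (inj₂ c1) k k' next =
  opposite (c1-parity {u = u} c1 k) (trans (c1-parity {u = u} c1 k') (cong odd next))

alternating-invariant : ∀ {m} (u : Fin (suc m) → ℤ) → ConsecutiveAlternate u →
                        ∀ j → odd ∣ u j ∣ xor odd (toℕ j) ≡ odd ∣ u Fin.zero ∣
alternating-invariant u alt Fin.zero = xor-identityʳ _
alternating-invariant {suc m} u alt (Fin.suc j) = begin
  odd ∣ u (Fin.suc j) ∣ xor not (odd (toℕ j)) ≡⟨ sym (not-distribʳ-xor (odd ∣ u (Fin.suc j) ∣) (odd (toℕ j))) ⟩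
  not (odd ∣ u (Fin.suc j) ∣ xor odd (toℕ j)) ≡⟨ cong not (alternating-invariant (u ∘ Fin.suc) shifted j) ⟩
  not (odd ∣ u (Fin.suc Fin.zero) ∣)          ≡⟨ sym (¬-not (alt Fin.zero (Fin.suc Fin.zero) refl)) ⟩
  odd ∣ u Fin.zero ∣                          ∎
  where
  open ≡-Reasoning
  shifted : ConsecutiveAlternate (u ∘ Fin.suc)
  shifted k k' next = alt (Fin.suc k) (Fin.suc k') (cong suc next)

consecutive⇒classes : ∀ {n} (u : Fin n → ℤ) → ConsecutiveAlternate u → InC0 n u ⊎ InC1 n u
consecutive⇒classes {zero}  u alt = inj₁ λ ()
consecutive⇒classes {suc m} u alt = byStart (odd ∣ u Fin.zero ∣) refl
  where
  byStart : ∀ b → odd ∣ u Fin.zero ∣ ≡ b → InC0 (suc m) u ⊎ InC1 (suc m) u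
  byStart true  start = inj₁ λ j →
    odd⇒%2 ∣ u j ∣ (suc (toℕ j)) (xor≡true (trans (alternating-invariant u alt j) start))
  byStart false start = inj₂ λ j c0 →
    not-¬ (xor≡false (trans (alternating-invariant u alt j) start)) (%2⇒odd ∣ u j ∣ (suc (toℕ j)) c0)

-- Pigeonhole: an injective endomap of Fin n is surjective.  A missed point y
-- would let f factor injectively through Fin (n - 1).
injective⇒surjective : ∀ {n} (f : Fin n → Fin n) → Injective _≡_ _≡_ f →
                       ∀ y → ∃ λ x → f x ≡ y
injective⇒surjective {suc m} f f-inj y with FinP.any? (λ x → f x FinP.≟ y)
... | yes hit   = hit
... | no missed = contradiction (FinP.injective⇒≤ squeeze-inj) ℕP.1+n≰n
  where
  squeeze : Fin (suc m) → Fin m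
  squeeze x = punchOut {i = y} {j = f x} λ y≡fx → missed (x , sym y≡fx)
  squeeze-inj : Injective _≡_ _≡_ squeeze
  squeeze-inj {a} {b} eq = f-inj (FinP.punchOut-injective
    (λ y≡fa → missed (a , sym y≡fa)) (λ y≡fb → missed (b , sym y≡fb)) eq)

positionOf : ∀ {n m} → 1 ≤ m → m ≤ n → ∃ λ (k : Fin n) → suc (toℕ k) ≡ m
positionOf {m = suc _} _ m≤n = fromℕ< m≤n , cong suc (FinP.toℕ-fromℕ< m≤n)

at≡ : ∀ {n} (w : Fin n → ℤ) i .(i<n : i < n) → at w i ≡ w (fromℕ< i<n)
at≡ {suc n} w zero    _   = refl
at≡ {suc n} w (suc i) i<n = at≡ (w ∘ Fin.suc) i (ℕ.s<s⁻¹ i<n)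

factorIndex : ∀ {n w u v} → IsParabolicFactorisation n w u v →
              ∀ j → ∃ λ k → w j ≡ u k × suc (toℕ k) ≡ ∣ v j ∣
factorIndex {n} {w} {u} {v} (_ , _ , ((vBounds , _) , vPositive) , w≡uv) j =
  entry (v j) (vPositive j) (proj₂ (vBounds j)) (w≡uv j)
  where
  entry : ∀ z → + 0 ℤ.< z → ∣ z ∣ ≤ n → w j ≡ ext u z →
          ∃ λ k → w j ≡ u k × suc (toℕ k) ≡ ∣ z ∣
  entry (+ suc i) _ i<n eq = fromℕ< i<n , trans eq (at≡ u i i<n) , cong suc (FinP.toℕ-fromℕ< i<n)
  entry (+ zero)  (+<+ ()) _ _
  entry -[1+ _ ]  () _ _

factor-classes : ∀ {n w u v} → InC0 n w → IsParabolicFactorisation n w u v →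
                 InC0 n u ⊎ InC1 n u → (InC0 n u × InC0 n v) ⊎ (InC1 n u × InC1 n v)
factor-classes {n} {w} {u} {v} wc0 pf (inj₁ uc0) = inj₁ (uc0 , vc0)
  where
  vc0 : InC0 n v
  vc0 j = let (k , wj≡uk , k≡vj) = factorIndex pf j in begin
    ∣ v j ∣ % 2         ≡⟨ cong (_% 2) (sym k≡vj) ⟩
    suc (toℕ k) % 2     ≡⟨ sym (uc0 k) ⟩
    ∣ u k ∣ % 2         ≡⟨ cong (λ z → ∣ z ∣ % 2) (sym wj≡uk) ⟩
    ∣ w j ∣ % 2         ≡⟨ wc0 j ⟩
    suc (toℕ j) % 2     ∎
    where open ≡-Reasoning
factor-classes {n} {w} {u} {v} wc0 pf (inj₂ uc1) = inj₂ (uc1 , vc1)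
  where
  vc1 : InC1 n v
  vc1 j vj≡j = let (k , wj≡uk , k≡vj) = factorIndex pf j in uc1 k (begin
    ∣ u k ∣ % 2         ≡⟨ cong (λ z → ∣ z ∣ % 2) (sym wj≡uk) ⟩
    ∣ w j ∣ % 2         ≡⟨ wc0 j ⟩
    suc (toℕ j) % 2     ≡⟨ sym vj≡j ⟩
    ∣ v j ∣ % 2         ≡⟨ cong (_% 2) (sym k≡vj) ⟩
    suc (toℕ k) % 2     ∎)
    where open ≡-Reasoning

-- Existence: sort the values of w.  v(j) is one more than the rank of w(j)
-- (the number of entries below it), and u lists the entries of w by rank.
module Sorting {n} (w : Fin n → ℤ) (wsp : IsSignedPerm n w) where

  below : Fin n → Subset n
  below j = tabulate λ x → does (w x ℤP.<? w j)

  ∈below⁺ : ∀ {x j} → w x ℤ.< w j → x ∈ below j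
  ∈below⁺ {x} {j} wx<wj =
    lookup⇒[]= x (below j) (trans (lookup∘tabulate _ x) (dec-true (w x ℤP.<? w j) wx<wj))

  ∈below⁻ : ∀ {x j} → x ∈ below j → w x ℤ.< w j
  ∈below⁻ {x} {j} x∈ with w x ℤP.<? w j | trans (sym (lookup∘tabulate _ x)) ([]=⇒lookup x∈)
  ... | yes wx<wj | _ = wx<wj
  ... | no _      | ()

  rank : Fin n → ℕ
  rank j = size (below j)

  rank-strict : ∀ {a b} → w a ℤ.< w b → rank a < rank b
  rank-strict {a} wa<wb = SubsetP.p⊂q⇒∣p∣<∣q∣
    ((λ x∈ → ∈below⁺ (ℤP.<-trans (∈below⁻ x∈) wa<wb)) ,
     a , ∈below⁺ wa<wb , λ a∈ → ℤP.<-irrefl refl (∈below⁻ a∈))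

  rank<n : ∀ j → rank j < n
  rank<n j = subst (rank j <_) (SubsetP.∣⊤∣≡n n)
    (SubsetP.p⊂q⇒∣p∣<∣q∣ (SubsetP.⊆⊤ , j , SubsetP.∈⊤ , λ j∈ → ℤP.<-irrefl refl (∈below⁻ j∈)))

  rank-injective : Injective _≡_ _≡_ rank
  rank-injective {a} {b} eq with ℤP.<-cmp (w a) (w b)
  ... | tri< wa<wb _ _ = contradiction eq (ℕP.<⇒≢ (rank-strict wa<wb))
  ... | tri≈ _ wa≡wb _ = proj₂ wsp a b (cong ∣_∣ wa≡wb)
  ... | tri> _ _ wb<wa = contradiction eq (ℕP.>⇒≢ (rank-strict wb<wa))

  position : Fin n → Fin n
  position j = fromℕ< (rank<n j)

  toℕ-position : ∀ j → toℕ (position j) ≡ rank j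
  toℕ-position j = FinP.toℕ-fromℕ< (rank<n j)

  position-injective : Injective _≡_ _≡_ position
  position-injective eq =
    rank-injective (trans (sym (toℕ-position _)) (trans (cong toℕ eq) (toℕ-position _)))

  atRank : Fin n → Fin n
  atRank k = proj₁ (injective⇒surjective position position-injective k)

  position-atRank : ∀ k → position (atRank k) ≡ k
  position-atRank k = proj₂ (injective⇒surjective position position-injective k)

  atRank-injective : Injective _≡_ _≡_ atRank
  atRank-injective {i} {j} eq =
    trans (sym (position-atRank i)) (trans (cong position eq) (position-atRank j))

  u : Fin n → ℤ
  u k = w (atRank k)

  v : Fin n → ℤ
  v j = + suc (rank j)

  u-ascending : Ascending n u
  u-ascending i j i<j with ℤP.<-cmp (u i) (u j)
  ... | tri< ui<uj _ _ = ui<uj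
  ... | tri≈ _ ui≡uj _ = contradiction (atRank-injective (proj₂ wsp _ _ (cong ∣_∣ ui≡uj)))
                           (FinP.<⇒≢ i<j)
  ... | tri> _ _ uj<ui = contradiction i<j (ℕP.<⇒≯ (subst₂ _<_ (rankOf j) (rankOf i) (rank-strict uj<ui)))
    where
    rankOf : ∀ k → rank (atRank k) ≡ toℕ k
    rankOf k = trans (sym (toℕ-position (atRank k))) (cong toℕ (position-atRank k))

  factorisation : IsParabolicFactorisation n w u v
  factorisation =
    ((λ k → proj₁ wsp (atRank k)) , (λ i j eq → atRank-injective (proj₂ wsp _ _ eq))) ,
    u-ascending ,
    (((λ j → s≤s z≤n , rank<n j) , (λ a b eq → rank-injective (ℕP.suc-injective eq))) ,
     (λ _ → +<+ (s≤s z≤n))) ,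
    λ j → sym (trans (at≡ u (rank j) (rank<n j))
                     (cong w (position-injective (position-atRank (position j)))))

parabolicFactorisation : ∀ {n} (w : Fin n → ℤ) → IsSignedPerm n w →
                         ∃₂ λ u v → IsParabolicFactorisation n w u v
parabolicFactorisation w wsp = u , v , factorisation
  where open Sorting w wsp

isPositive-neg : ∀ z → 1 ≤ ∣ z ∣ → isPositive (ℤ.- z) ≡ not (isPositive z)
isPositive-neg (+ suc _) _ = refl
isPositive-neg -[1+ _ ]  _ = refl

neg-moves : ∀ z → 1 ≤ ∣ z ∣ → ℤ.- z ≢ z
neg-moves (+ suc _) _ ()
neg-moves -[1+ _ ]  _ ()

-- If a signed permutation u takes every signed value of e, it takes nothing else:
-- for each r ∈ [n] it takes +r or −r, and not both.
range⊆signedValue : ∀ {n e} {u : Fin n → ℤ} → IsSignedPerm n u →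
                    SignedValue n e ⊆ Range u → Range u ⊆ SignedValue n e
range⊆signedValue {n} {e} {u} (bounds , abs-inj) covered (k , refl) =
  proj₁ (bounds k) , proj₂ (bounds k) , sign
  where
  sign : e ∣ u k ∣ ≡ isPositive (u k)
  sign with e ∣ u k ∣ BoolP.≟ isPositive (u k)
  ... | yes agree = agree
  ... | no disagree with covered {ℤ.- u k} mirrored
    where
    mirrored : SignedValue n e (ℤ.- u k)
    mirrored = subst (1 ≤_) (sym |-uk|) (proj₁ (bounds k)) ,
               subst (_≤ n) (sym |-uk|) (proj₂ (bounds k)) ,
               trans (cong e |-uk|)
                 (trans (¬-not disagree) (sym (isPositive-neg (u k) (proj₁ (bounds k)))))
      where
      |-uk| : ∣ ℤ.- u k ∣ ≡ ∣ u k ∣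
      |-uk| = ℤP.∣-i∣≡∣i∣ (u k)
  ... | k' , uk'≡-uk = contradiction
    (trans (sym uk'≡-uk) (cong u (abs-inj k' k (trans (cong ∣_∣ uk'≡-uk) (ℤP.∣-i∣≡∣i∣ (u k))))))
    (neg-moves (u k) (proj₁ (bounds k)))

module ValueSet {n} (w : Fin n → ℤ) (wsp : IsSignedPerm n w) where

  ε-witness : ∀ {r} → ε w r ≡ true → ∃ λ j → w j ≡ + r
  ε-witness {r} εr with satisfied (any⁻ (λ j → ⌊ w j ℤ.≟ + r ⌋) (allFin n) (Equivalence.from T-≡ εr))
  ... | j , hit = j , toWitness hit

  ε-positive : ∀ {r j} → w j ≡ + r → ε w r ≡ true
  ε-positive {r} {j} wj≡r =
    Equivalence.to T-≡ (any⁺ (λ j → ⌊ w j ℤ.≟ + r ⌋) (lose (∈-allFin j) (fromWitness wj≡r)))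

  slot : Fin n → Fin n
  slot j = proj₁ (positionOf (proj₁ (proj₁ wsp j)) (proj₂ (proj₁ wsp j)))

  slot-spec : ∀ j → suc (toℕ (slot j)) ≡ ∣ w j ∣
  slot-spec j = proj₂ (positionOf (proj₁ (proj₁ wsp j)) (proj₂ (proj₁ wsp j)))

  slot-injective : Injective _≡_ _≡_ slot
  slot-injective {i} {j} eq =
    proj₂ wsp i j (trans (sym (slot-spec i)) (trans (cong (suc ∘ toℕ) eq) (slot-spec j)))

  abs-surjective : ∀ {r} → 1 ≤ r → r ≤ n → ∃ λ j → ∣ w j ∣ ≡ r
  abs-surjective 1≤r r≤n =
    let (k , k≡r)      = positionOf 1≤r r≤n
        (j , slotj≡k)  = injective⇒surjective slot slot-injective k
    in j , trans (sym (slot-spec j)) (trans (cong (suc ∘ toℕ) slotj≡k) k≡r)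

  signedValue⊆range : SignedValue n (ε w) ⊆ Range w
  signedValue⊆range {+ _} (_ , _ , εr) = ε-witness εr
  signedValue⊆range { -[1+ s ]} (_ , s<n , εs) with abs-surjective (s≤s z≤n) s<n
  ... | j , |wj| = j , negative (w j) |wj| λ wj≡s → contradiction (trans (sym εs) (ε-positive wj≡s)) λ ()
    where
    negative : ∀ z → ∣ z ∣ ≡ suc s → z ≢ + suc s → z ≡ -[1+ s ]
    negative (+ _)    refl ne = contradiction refl ne
    negative -[1+ _ ] refl _  = refl

factor-values : ∀ {n w u v} → IsSignedPerm n w → IsParabolicFactorisation n w u v →
                SignedValue n (ε w) ⊆ Range u × Range u ⊆ SignedValue n (ε w)
factor-values {n} {w} {u} wsp pf@(usp , _) = covered , range⊆signedValue {e = ε w} usp covered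
  where
  covered : SignedValue n (ε w) ⊆ Range u
  covered sv with ValueSet.signedValue⊆range w wsp sv
  ... | j , refl = let (k , wj≡uk , _) = factorIndex pf j in k , sym wj≡uk

classes⇒noSandwich : ∀ {n w u v} → IsSignedPerm n w → IsParabolicFactorisation n w u v →
                     InC0 n u ⊎ InC1 n u → ¬ HasOddSandwich n w
classes⇒noSandwich {n} {w} {u} wsp pf@(_ , ascending , _) classes =
  SignVector.alternates⇒noSandwich n (ε w)
    (alternates-resp toSigned fromSigned
      (AscendingEnumeration.consecutive⇒alternates u ascending (classes⇒consecutive u classes)))
  where
  fromSigned : SignedValue n (ε w) ⊆ Range u
  fromSigned = proj₁ (factor-values wsp pf)
  toSigned : Range u ⊆ SignedValue n (ε w)
  toSigned = proj₂ (factor-values wsp pf)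

noSandwich⇒classes : ∀ {n w u v} → IsSignedPerm n w → IsParabolicFactorisation n w u v →
                     ¬ HasOddSandwich n w → InC0 n u ⊎ InC1 n u
noSandwich⇒classes {n} {w} {u} wsp pf@(_ , ascending , _) noSandwich =
  consecutive⇒classes u (AscendingEnumeration.alternates⇒consecutive u ascending
    (alternates-resp fromSigned toSigned (SignVector.noSandwich⇒alternates n (ε w) noSandwich)))
  where
  fromSigned : SignedValue n (ε w) ⊆ Range u
  fromSigned = proj₁ (factor-values wsp pf)
  toSigned : Range u ⊆ SignedValue n (ε w)
  toSigned = proj₂ (factor-values wsp pf)

lemma5p4 : (n : ℕ) (w : Fin n → ℤ) → IsSignedPerm n w → InC0 n w →
    (InM n w → ¬ HasOddSandwich n w) × (¬ HasOddSandwich n w → InM n w)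
lemma5p4 n w wsp wc0 = inM⇒noSandwich , noSandwich⇒inM
  where
  inM⇒noSandwich : InM n w → ¬ HasOddSandwich n w
  inM⇒noSandwich (_ , split) =
    let (u , v , pf) = parabolicFactorisation w wsp
    in classes⇒noSandwich wsp pf (Sum.map proj₁ proj₁ (split u v pf))

  noSandwich⇒inM : ¬ HasOddSandwich n w → InM n w
  noSandwich⇒inM noSandwich =
    wc0 , λ u v pf → factor-classes wc0 pf (noSandwich⇒classes wsp pf noSandwich)
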